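{- For every integer $k \geq 1$, let $M_k$ be the $k \times k$ matrix whose entry in row $i$ and column $j$ ($0 \leq i,j < k$) is $2^{ij}$ (the Vandermonde matrix $V(1,2,4,\ldots,2^{k-1})$), and let $\ell_k$ be the largest absolute value of an entry of $M_k^{ -1}$. Then $\ell_k < 34$.
   Context: The Vandermonde matrix $V(a_0,\ldots,a_{k-1})$ is the $k\times k$ matrix with entry $a_i^j$ in row $i$, column $j$, indices starting at $0$; it is invertible when the $a_i$ are distinct. -}

module Defs where

open import Data.Nat as ℕ using (ℕ; suc)
open import Data.Fin using (Fin; toℕ)
open import Data.Rational using (ℚ; _+_; _*_; 0ℚ; 1ℚ)
open import Data.Vec.Functional using (foldr)
open import Relation.Binary.PropositionalEquality using (_≡_)
open import Relation.Nullary using (yes; no)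
open import Data.Product using (_×_)
import Data.Rational as Q
import Data.Integer as ℤ

ℕtoℚ : ℕ → ℚ
ℕtoℚ n = (ℤ.+ n) Q./ 1

Matrix : ℕ → Set
Matrix k = Fin k → Fin k → ℚ

Σℚ : ∀ {k} → (Fin k → ℚ) → ℚ
Σℚ f = foldr _+_ 0ℚ f

_·_ : ∀ {k} → Matrix k → Matrix k → Matrix k
(A · B) i j = Σℚ (λ m → A i m * B m j)

identity : ∀ {k} → Matrix k
identity i j with toℕ i ℕ.≟ toℕ j
... | yes _ = 1ℚ
... | no _ = 0ℚ

M : (k : ℕ) → Matrix k
M k i j = ℕtoℚ (2 ℕ.^ (toℕ i ℕ.* toℕ j))

IsInverse : ∀ {k} → Matrix k → Matrix k → Set
IsInverse A N = (∀ i j → (A · N) i j ≡ identity i j) × (∀ i j → (N · A) i j ≡ identity i j)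

{-# OPTIONS --safe #-}
module Submission where

-- The inverse of the Vandermonde matrix on nodes x₀, …, x_{k-1} has as its j-th column the
-- coefficients of the Lagrange polynomial ∏_{r≠j} (x - x_r) / ∏_{r≠j} (x_j - x_r).
-- Multiplying a polynomial by x - a multiplies its largest coefficient by at most 1 + |a|, so for
-- x_r = 2^r the numerator has coefficients bounded by ∏_{r≠j} (1 + 2^r), while the denominator
-- has absolute value ∏_{r≠j} |2^j - 2^r|.  Their ratio is below 20: the factors with r < j
-- contribute at most 2 in total, and the factors with r > j are controlled by an invariant with
-- slack, bounding the ratio by 20 (1 - 4·2^(j-k)) from k = j + 3 on.  That the matrix built this way
-- is also a left inverse follows because a polynomial of degree < k is determined by its values
-- at k distinct nodes.

open import Defs
open import Data.Nat.Base as ℕ using (ℕ; zero; suc; z≤n; s≤s; _^_)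
import Data.Nat.Properties as ℕ
import Data.Integer.Base as ℤ
import Data.Integer.Properties as ℤ
open import Data.Rational.Base as ℚ using (ℚ; 0ℚ; 1ℚ; 1/_)
import Data.Rational.Properties as ℚ
open import Data.Rational.Unnormalised.Base as ℚᵘ using (mkℚᵘ; *≡*; *≤*; *<*)
import Data.Rational.Unnormalised.Properties as ℚᵘ
open import Data.Fin.Base using (Fin; toℕ; fromℕ<; punchIn) renaming (zero to fzero; suc to fsuc)
open import Data.Fin.Properties using (toℕ-injective; toℕ<n; toℕ-fromℕ<; punchInᵢ≢i)
open import Data.Empty using (⊥-elim)
open import Data.Product using (Σ; _×_; _,_)
open import Data.Sum using (inj₁; inj₂)
open import Function.Base using (_∘_)
open import Algebra.Bundles using (CommutativeRing)
open import Algebra.Properties.Group ℚ.+-0-group using () renaming (x∙y⁻¹≈ε⇒x≈y to p-q≡0⇒p≡q)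
open import Algebra.Properties.Semiring.Sum (CommutativeRing.semiring ℚ.+-*-commutativeRing)
  using (sum-cong-≗; sum-remove; sum-replicate-zero; *-distribˡ-sum; *-distribʳ-sum; ∑-comm)
open import Relation.Binary.Definitions using (tri<; tri≈; tri>)
open import Relation.Binary.PropositionalEquality
open import Relation.Nullary using (Dec; yes; no)

-- foldExcept encodes the products ∏_{r<k, r≠j}.
foldExcept : {A : Set} → (ℕ → A → A) → A → ℕ → ℕ → A
foldExcept f z zero    j = z
foldExcept f z (suc k) j with k ℕ.≟ j
... | yes _ = foldExcept f z k j
... | no  _ = f k (foldExcept f z k j)

foldExcept-skip : ∀ {A : Set} {f : ℕ → A → A} {z} j →
                  foldExcept f z (suc j) j ≡ foldExcept f z j j
foldExcept-skip j with j ℕ.≟ j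
... | yes _   = refl
... | no  j≢j = ⊥-elim (j≢j refl)

foldExcept-step : ∀ {A : Set} {f : ℕ → A → A} {z k j} → k ≢ j →
                  foldExcept f z (suc k) j ≡ f k (foldExcept f z k j)
foldExcept-step {k = k} {j} k≢j with k ℕ.≟ j
... | yes k≡j = ⊥-elim (k≢j k≡j)
... | no  _   = refl

module GapEstimate where

  open import Data.Nat
  open import Data.Nat.Properties
  open import Data.Nat.Solver using (module +-*-Solver)
  open +-*-Solver

  gapProduct : ℕ → ℕ → ℕ
  gapProduct k j = foldExcept (λ r → ∣ 2 ^ j - 2 ^ r ∣ *_) 1 k j

  coeffBound : ℕ → ℕ → ℕ
  coeffBound k j = foldExcept (λ r → (1 + 2 ^ r) *_) 1 k j

  coeffBound-skip : ∀ j → coeffBound (suc j) j ≡ coeffBound j j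
  coeffBound-skip j = foldExcept-skip j

  coeffBound-step : ∀ {k j} → k ≢ j → coeffBound (suc k) j ≡ (1 + 2 ^ k) * coeffBound k j
  coeffBound-step = foldExcept-step

  gapProduct-skip : ∀ j → gapProduct (suc j) j ≡ gapProduct j j
  gapProduct-skip j = foldExcept-skip j

  gapProduct-step : ∀ {k j} → k ≢ j → gapProduct (suc k) j ≡ ∣ 2 ^ j - 2 ^ k ∣ * gapProduct k j
  gapProduct-step = foldExcept-step

  2^n≡2^m+∣2^m-2^n∣ : ∀ {m n} → m ≤ n → 2 ^ n ≡ 2 ^ m + ∣ 2 ^ m - 2 ^ n ∣
  2^n≡2^m+∣2^m-2^n∣ {m} {n} m≤n = begin
    2 ^ n                     ≡⟨ m+[n∸m]≡n 2^m≤2^n ⟨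
    2 ^ m + (2 ^ n ∸ 2 ^ m)   ≡⟨ cong (2 ^ m +_) (m≤n⇒∣m-n∣≡n∸m 2^m≤2^n) ⟨
    2 ^ m + ∣ 2 ^ m - 2 ^ n ∣ ∎
    where
    open ≡-Reasoning
    2^m≤2^n = ^-monoʳ-≤ 2 m≤n

  ∣2^n-2^[1+n]∣≡2^n : ∀ n → ∣ 2 ^ n - 2 ^ suc n ∣ ≡ 2 ^ n
  ∣2^n-2^[1+n]∣≡2^n n = +-cancelˡ-≡ (2 ^ n) _ _
    (trans (sym (2^n≡2^m+∣2^m-2^n∣ (n≤1+n n))) (solve 1 (λ x → con 2 :* x := x :+ x) refl (2 ^ n)))

  ∣2^n-2^[2+n]∣≡3*2^n : ∀ n → ∣ 2 ^ n - 2 ^ suc (suc n) ∣ ≡ 3 * 2 ^ n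
  ∣2^n-2^[2+n]∣≡3*2^n n = +-cancelˡ-≡ (2 ^ n) _ _
    (trans (sym (2^n≡2^m+∣2^m-2^n∣ (m≤n+m n 2)))
           (solve 1 (λ x → con 2 :* (con 2 :* x) := x :+ con 3 :* x) refl (2 ^ n)))

  1+2^m≤∣2^n-2^m∣ : ∀ {m n} → 2 + m ≤ n → 1 + 2 ^ m ≤ ∣ 2 ^ n - 2 ^ m ∣
  1+2^m≤∣2^n-2^m∣ {m} {n} 2+m≤n = +-cancelˡ-≤ (2 ^ m) _ _ (begin
    2 ^ m + (1 + 2 ^ m)          ≤⟨ +-monoʳ-≤ (2 ^ m) (+-monoˡ-≤ (2 ^ m) (m^n>0 2 m)) ⟩
    2 ^ m + (2 ^ m + 2 ^ m)      ≤⟨ m≤m+n _ (2 ^ m) ⟩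
    2 ^ m + (2 ^ m + 2 ^ m) + 2 ^ m
      ≡⟨ solve 1 (λ x → x :+ (x :+ x) :+ x := con 2 :* (con 2 :* x)) refl (2 ^ m) ⟩
    2 ^ (2 + m)                  ≤⟨ ^-monoʳ-≤ 2 2+m≤n ⟩
    2 ^ n                        ≡⟨ 2^n≡2^m+∣2^m-2^n∣ (≤-trans (m≤n+m m 2) 2+m≤n) ⟩
    2 ^ m + ∣ 2 ^ m - 2 ^ n ∣    ≡⟨ cong (2 ^ m +_) (∣-∣-comm (2 ^ m) (2 ^ n)) ⟩
    2 ^ m + ∣ 2 ^ n - 2 ^ m ∣    ∎)
    where open ≤-Reasoning

  coeffBound≤gapProduct : ∀ {k j} → k < j → coeffBound k j ≤ gapProduct k j
  coeffBound≤gapProduct {zero}      _     = ≤-refl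
  coeffBound≤gapProduct {suc k} {j} 1+k<j = begin
    coeffBound (suc k) j                     ≡⟨ coeffBound-step k≢j ⟩
    (1 + 2 ^ k) * coeffBound k j             ≤⟨ *-mono-≤ (1+2^m≤∣2^n-2^m∣ 1+k<j) (coeffBound≤gapProduct k<j) ⟩
    ∣ 2 ^ j - 2 ^ k ∣ * gapProduct k j       ≡⟨ gapProduct-step k≢j ⟨
    gapProduct (suc k) j                     ∎
    where
    open ≤-Reasoning
    k<j = <-trans (n<1+n k) 1+k<j
    k≢j = <⇒≢ k<j

  coeffBound-diagonal : ∀ j → coeffBound j j ≤ 2 * gapProduct j j
  coeffBound-diagonal zero    = s≤s z≤n
  coeffBound-diagonal (suc i) = begin
    coeffBound (suc i) (suc i)                    ≡⟨ coeffBound-step i≢1+i ⟩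
    (1 + 2 ^ i) * coeffBound i (suc i)
      ≤⟨ *-mono-≤ (+-monoˡ-≤ (2 ^ i) (m^n>0 2 i)) (coeffBound≤gapProduct (n<1+n i)) ⟩
    (2 ^ i + 2 ^ i) * w
      ≡⟨ solve 2 (λ x w → (x :+ x) :* w := con 2 :* (x :* w)) refl (2 ^ i) w ⟩
    2 * (2 ^ i * w)
      ≡⟨ cong (λ d → 2 * (d * w)) (trans (∣-∣-comm (2 ^ suc i) (2 ^ i)) (∣2^n-2^[1+n]∣≡2^n i)) ⟨
    2 * (∣ 2 ^ suc i - 2 ^ i ∣ * w)
      ≡⟨ cong (2 *_) (gapProduct-step i≢1+i) ⟨
    2 * gapProduct (suc i) (suc i) ∎
    where
    open ≤-Reasoning
    w = gapProduct i (suc i)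
    i≢1+i = <⇒≢ (n<1+n i)

  2^-injective : ∀ {m n} → 2 ^ m ≡ 2 ^ n → m ≡ n
  2^-injective {m} {n} eq with <-cmp m n
  ... | tri< m<n _ _ = ⊥-elim (<-irrefl eq (^-monoʳ-< 2 (s≤s (s≤s z≤n)) m<n))
  ... | tri≈ _ m≡n _ = m≡n
  ... | tri> _ _ n<m = ⊥-elim (<-irrefl (sym eq) (^-monoʳ-< 2 (s≤s (s≤s z≤n)) n<m))

  ∣2^m-2^n∣>0 : ∀ {m n} → m ≢ n → 0 < ∣ 2 ^ m - 2 ^ n ∣
  ∣2^m-2^n∣>0 m≢n = n≢0⇒n>0 (m≢n ∘ 2^-injective ∘ ∣m-n∣≡0⇒m≡n)

  gapProduct>0 : ∀ k j → 0 < gapProduct k j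
  gapProduct>0 zero    j = s≤s z≤n
  gapProduct>0 (suc k) j with k ≟ j
  ... | yes _   = gapProduct>0 k j
  ... | no  k≢j = *-mono-< (∣2^m-2^n∣>0 (≢-sym k≢j)) (gapProduct>0 k j)

  -- coeffBound k j / gapProduct k j ≤ 20 (1 - 4·2^(j-k)), cleared of denominators.
  CoeffRatioBound : ℕ → ℕ → Set
  CoeffRatioBound j k = coeffBound k j * 2 ^ k + 80 * 2 ^ j * gapProduct k j ≤ 20 * 2 ^ k * gapProduct k j

  -- In the arithmetic lemmas u = 2^j, m = 2^k = u + v, and c, w stand for coeffBound, gapProduct.
  coeffRatioBound-step-arith : ∀ u v m c w → 1 ≤ u → m ≡ u + v →
    c * m + 80 * u * w ≤ 20 * m * w →
    (1 + m) * c * (2 * m) + 80 * u * (v * w) ≤ 20 * (2 * m) * (v * w)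
  coeffRatioBound-step-arith u@(suc t) v _ c w _ refl bound = +-cancelʳ-≤ slack _ _ (begin
    (1 + m) * c * (2 * m) + 80 * u * (v * w) + slack
      ≡⟨ solve 4 (λ t v c w → let u = con 1 :+ t; m = u :+ v in
                   (con 1 :+ m) :* c :* (con 2 :* m) :+ con 80 :* u :* (v :* w) :+ con 160 :* u :* (con 1 :+ m) :* w
                   := con 2 :* (con 1 :+ m) :* (c :* m :+ con 80 :* u :* w) :+ con 80 :* u :* v :* w) refl t v c w ⟩
    2 * (1 + m) * (c * m + 80 * u * w) + 80 * u * v * w
      ≤⟨ +-monoˡ-≤ (80 * u * v * w) (*-monoʳ-≤ (2 * (1 + m)) bound) ⟩
    2 * (1 + m) * (20 * m * w) + 80 * u * v * w
      ≡⟨ solve 3 (λ t v w → let u = con 1 :+ t; m = u :+ v in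
                   con 2 :* (con 1 :+ m) :* (con 20 :* m :* w) :+ con 80 :* u :* v :* w
                   := con 40 :* w :* (m :* (con 1 :+ m) :+ con 2 :* u :* v)) refl t v w ⟩
    40 * w * (m * (1 + m) + 2 * u * v)
      ≤⟨ *-monoʳ-≤ (40 * w) key ⟩
    40 * w * (m * v + 4 * u * (1 + m))
      ≡⟨ solve 3 (λ t v w → let u = con 1 :+ t; m = u :+ v in
                   con 40 :* w :* (m :* v :+ con 4 :* u :* (con 1 :+ m))
                   := con 20 :* (con 2 :* m) :* (v :* w) :+ con 160 :* u :* (con 1 :+ m) :* w) refl t v w ⟩
    20 * (2 * m) * (v * w) + slack ∎)
    where
    open ≤-Reasoning
    m = u + v
    slack = 160 * u * (1 + m) * w
    key : m * (1 + m) + 2 * u * v ≤ m * v + 4 * u * (1 + m)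
    key = begin
      m * (1 + m) + 2 * u * v                             ≤⟨ m≤m+n _ (v * t + 3 * u + 3 * u * u) ⟩
      m * (1 + m) + 2 * u * v + (v * t + 3 * u + 3 * u * u)
        ≡⟨ solve 2 (λ t v → let u = con 1 :+ t; m = u :+ v in
                     m :* (con 1 :+ m) :+ con 2 :* u :* v :+ (v :* t :+ con 3 :* u :+ con 3 :* u :* u)
                     := m :* v :+ con 4 :* u :* (con 1 :+ m)) refl t v ⟩
      m * v + 4 * u * (1 + m)                             ∎

  coeffRatioBound-step : ∀ {j k} → j < k → CoeffRatioBound j k → CoeffRatioBound j (suc k)
  coeffRatioBound-step {j} {k} j<k bound
    rewrite coeffBound-step (≢-sym (<⇒≢ j<k)) | gapProduct-step (≢-sym (<⇒≢ j<k)) =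
    coeffRatioBound-step-arith (2 ^ j) ∣ 2 ^ j - 2 ^ k ∣ (2 ^ k) (coeffBound k j) (gapProduct k j)
      (m^n>0 2 j) (2^n≡2^m+∣2^m-2^n∣ (<⇒≤ j<k)) bound

  coeffRatioBound-base-arith : ∀ u c w → 1 ≤ u → c ≤ 2 * w →
    (1 + 2 * (2 * u)) * ((1 + 2 * u) * c) * (2 * (2 * (2 * u))) + 80 * u * (3 * u * (u * w))
      ≤ 20 * (2 * (2 * (2 * u))) * (3 * u * (u * w))
  coeffRatioBound-base-arith u@(suc t) c w _ c≤2w = begin
    (1 + 2 * (2 * u)) * ((1 + 2 * u) * c) * (2 * (2 * (2 * u))) + 80 * u * (3 * u * (u * w))
      ≤⟨ +-monoˡ-≤ (80 * u * (3 * u * (u * w)))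
           (*-monoˡ-≤ (2 * (2 * (2 * u))) (*-monoʳ-≤ (1 + 2 * (2 * u)) (*-monoʳ-≤ (1 + 2 * u) c≤2w))) ⟩
    (1 + 2 * (2 * u)) * ((1 + 2 * u) * (2 * w)) * (2 * (2 * (2 * u))) + 80 * u * (3 * u * (u * w))
      ≤⟨ m≤m+n _ (w * (112 * t * t * t + 240 * t * t + 128 * t)) ⟩
    (1 + 2 * (2 * u)) * ((1 + 2 * u) * (2 * w)) * (2 * (2 * (2 * u))) + 80 * u * (3 * u * (u * w))
      + w * (112 * t * t * t + 240 * t * t + 128 * t)
      ≡⟨ solve 2 (λ t w → let u = con 1 :+ t in
                   (con 1 :+ con 2 :* (con 2 :* u)) :* ((con 1 :+ con 2 :* u) :* (con 2 :* w)) :* (con 2 :* (con 2 :* (con 2 :* u)))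
                   :+ con 80 :* u :* (con 3 :* u :* (u :* w)) :+ w :* (con 112 :* t :* t :* t :+ con 240 :* t :* t :+ con 128 :* t)
                   := con 20 :* (con 2 :* (con 2 :* (con 2 :* u))) :* (con 3 :* u :* (u :* w))) refl t w ⟩
    20 * (2 * (2 * (2 * u))) * (3 * u * (u * w)) ∎
    where open ≤-Reasoning

  coeffRatioBound-base : ∀ j → CoeffRatioBound j (3 + j)
  coeffRatioBound-base j
    rewrite coeffBound-step (≢-sym (<⇒≢ (m<n+m j {2} (s≤s z≤n))))
          | coeffBound-step (≢-sym (<⇒≢ (n<1+n j))) | coeffBound-skip j
          | gapProduct-step (≢-sym (<⇒≢ (m<n+m j {2} (s≤s z≤n))))
          | gapProduct-step (≢-sym (<⇒≢ (n<1+n j))) | gapProduct-skip j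
          | ∣2^n-2^[1+n]∣≡2^n j | ∣2^n-2^[2+n]∣≡3*2^n j
    = coeffRatioBound-base-arith (2 ^ j) (coeffBound j j) (gapProduct j j)
        (m^n>0 2 j) (coeffBound-diagonal j)

  coeffRatioBound : ∀ n j → CoeffRatioBound j (3 + n + j)
  coeffRatioBound zero    j = coeffRatioBound-base j
  coeffRatioBound (suc n) j = coeffRatioBound-step (s≤s (m≤n+m j (2 + n))) (coeffRatioBound n j)

  coeffBound-near-arith : ∀ u c w → 1 ≤ u → c ≤ 2 * w → (1 + 2 * u) * c ≤ 20 * (u * w)
  coeffBound-near-arith u@(suc t) c w _ c≤2w = begin
    (1 + 2 * u) * c                                ≤⟨ *-monoʳ-≤ (1 + 2 * u) c≤2w ⟩
    (1 + 2 * u) * (2 * w)                          ≤⟨ m≤m+n _ (w * (16 * t + 14)) ⟩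
    (1 + 2 * u) * (2 * w) + w * (16 * t + 14)
      ≡⟨ solve 2 (λ t w → (con 1 :+ con 2 :* (con 1 :+ t)) :* (con 2 :* w) :+ w :* (con 16 :* t :+ con 14)
                          := con 20 :* ((con 1 :+ t) :* w)) refl t w ⟩
    20 * (u * w)                                   ∎
    where open ≤-Reasoning

  coeffBound≤20*gapProduct′ : ∀ d j → coeffBound (suc d + j) j ≤ 20 * gapProduct (suc d + j) j
  coeffBound≤20*gapProduct′ zero j
    rewrite coeffBound-skip j | gapProduct-skip j =
    ≤-trans (coeffBound-diagonal j) (*-monoˡ-≤ (gapProduct j j) (m≤m+n 2 18))
  coeffBound≤20*gapProduct′ (suc zero) j
    rewrite coeffBound-step (≢-sym (<⇒≢ (n<1+n j))) | coeffBound-skip j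
          | gapProduct-step (≢-sym (<⇒≢ (n<1+n j))) | gapProduct-skip j | ∣2^n-2^[1+n]∣≡2^n j
    = coeffBound-near-arith (2 ^ j) (coeffBound j j) (gapProduct j j) (m^n>0 2 j) (coeffBound-diagonal j)
  coeffBound≤20*gapProduct′ (suc (suc n)) j =
    *-cancelʳ-≤ (coeffBound k j) (20 * gapProduct k j) (2 ^ k) {{m^n≢0 2 k}} (begin
    coeffBound k j * 2 ^ k                                     ≤⟨ m≤m+n _ _ ⟩
    coeffBound k j * 2 ^ k + 80 * 2 ^ j * gapProduct k j       ≤⟨ coeffRatioBound n j ⟩
    20 * 2 ^ k * gapProduct k j                                ≡⟨ *-assoc 20 (2 ^ k) (gapProduct k j) ⟩
    20 * (2 ^ k * gapProduct k j)                              ≡⟨ cong (20 *_) (*-comm (2 ^ k) (gapProduct k j)) ⟩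
    20 * (gapProduct k j * 2 ^ k)                              ≡⟨ *-assoc 20 (gapProduct k j) (2 ^ k) ⟨
    20 * gapProduct k j * 2 ^ k                                ∎)
    where
    open ≤-Reasoning
    k = 3 + n + j

  coeffBound≤20*gapProduct : ∀ {j k} → j < k → coeffBound k j ≤ 20 * gapProduct k j
  coeffBound≤20*gapProduct {j} j<k with m≤n⇒∃[o]m+o≡n j<k
  ... | d , refl rewrite +-comm j d = coeffBound≤20*gapProduct′ d j

open GapEstimate using (gapProduct; coeffBound; 2^-injective; gapProduct>0; coeffBound≤20*gapProduct)
open import Data.Rational.Base using (_+_; _*_; _-_; -_; ∣_∣; _≤_; _<_)
open import Data.Rational.Solver using (module +-*-Solver)
open +-*-Solver

toℚᵘ-ℕtoℚ : ∀ n → ℚ.toℚᵘ (ℕtoℚ n) ℚᵘ.≃ mkℚᵘ (ℤ.+ n) 0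
toℚᵘ-ℕtoℚ n = ℚ.toℚᵘ-fromℚᵘ (mkℚᵘ (ℤ.+ n) 0)

ℕtoℚ-homo-+ : ∀ a b → ℕtoℚ (a ℕ.+ b) ≡ ℕtoℚ a + ℕtoℚ b
ℕtoℚ-homo-+ a b = ℚ.toℚᵘ-injective (begin
  ℚ.toℚᵘ (ℕtoℚ (a ℕ.+ b))                      ≈⟨ toℚᵘ-ℕtoℚ (a ℕ.+ b) ⟩
  mkℚᵘ (ℤ.+ (a ℕ.+ b)) 0                          ≈⟨ *≡* (cong (ℤ._* ℤ.+ 1) (trans (ℤ.pos-+ a b)
                                                     (sym (cong₂ ℤ._+_ (ℤ.*-identityʳ (ℤ.+ a)) (ℤ.*-identityʳ (ℤ.+ b)))))) ⟩
  mkℚᵘ (ℤ.+ a) 0 ℚᵘ.+ mkℚᵘ (ℤ.+ b) 0               ≈⟨ ℚᵘ.+-cong (toℚᵘ-ℕtoℚ a) (toℚᵘ-ℕtoℚ b) ⟨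
  ℚ.toℚᵘ (ℕtoℚ a) ℚᵘ.+ ℚ.toℚᵘ (ℕtoℚ b)         ≈⟨ ℚ.toℚᵘ-homo-+ (ℕtoℚ a) (ℕtoℚ b) ⟨
  ℚ.toℚᵘ (ℕtoℚ a + ℕtoℚ b)                     ∎)
  where open ℚᵘ.≃-Reasoning

ℕtoℚ-homo-* : ∀ a b → ℕtoℚ (a ℕ.* b) ≡ ℕtoℚ a * ℕtoℚ b
ℕtoℚ-homo-* a b = ℚ.toℚᵘ-injective (begin
  ℚ.toℚᵘ (ℕtoℚ (a ℕ.* b))                      ≈⟨ toℚᵘ-ℕtoℚ (a ℕ.* b) ⟩
  mkℚᵘ (ℤ.+ (a ℕ.* b)) 0                          ≈⟨ *≡* (cong (ℤ._* ℤ.+ 1) (ℤ.pos-* a b)) ⟩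
  mkℚᵘ (ℤ.+ a) 0 ℚᵘ.* mkℚᵘ (ℤ.+ b) 0               ≈⟨ ℚᵘ.*-cong (toℚᵘ-ℕtoℚ a) (toℚᵘ-ℕtoℚ b) ⟨
  ℚ.toℚᵘ (ℕtoℚ a) ℚᵘ.* ℚ.toℚᵘ (ℕtoℚ b)         ≈⟨ ℚ.toℚᵘ-homo-* (ℕtoℚ a) (ℕtoℚ b) ⟨
  ℚ.toℚᵘ (ℕtoℚ a * ℕtoℚ b)                     ∎)
  where open ℚᵘ.≃-Reasoning

ℕtoℚ-mono-≤ : ∀ {a b} → a ℕ.≤ b → ℕtoℚ a ≤ ℕtoℚ b
ℕtoℚ-mono-≤ {a} {b} a≤b = ℚ.toℚᵘ-cancel-≤
  (ℚᵘ.≤-respˡ-≃ (ℚᵘ.≃-sym (toℚᵘ-ℕtoℚ a)) (ℚᵘ.≤-respʳ-≃ (ℚᵘ.≃-sym (toℚᵘ-ℕtoℚ b))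
    (*≤* (ℤ.*-monoʳ-≤-nonNeg (ℤ.+ 1) (ℤ.+≤+ a≤b)))))

ℕtoℚ-mono-< : ∀ {a b} → a ℕ.< b → ℕtoℚ a < ℕtoℚ b
ℕtoℚ-mono-< {a} {b} a<b = ℚ.toℚᵘ-cancel-<
  (ℚᵘ.<-respˡ-≃ (ℚᵘ.≃-sym (toℚᵘ-ℕtoℚ a)) (ℚᵘ.<-respʳ-≃ (ℚᵘ.≃-sym (toℚᵘ-ℕtoℚ b))
    (*<* (ℤ.*-monoʳ-<-pos (ℤ.+ 1) (ℤ.+<+ a<b)))))

ℕtoℚ-injective : ∀ {a b} → ℕtoℚ a ≡ ℕtoℚ b → a ≡ b
ℕtoℚ-injective {a} {b} eq with ℕ.<-cmp a b
... | tri< a<b _ _ = ⊥-elim (ℚ.<-irrefl eq (ℕtoℚ-mono-< a<b))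
... | tri≈ _ a≡b _ = a≡b
... | tri> _ _ b<a = ⊥-elim (ℚ.<-irrefl (sym eq) (ℕtoℚ-mono-< b<a))

0≤ℕtoℚ : ∀ n → 0ℚ ≤ ℕtoℚ n
0≤ℕtoℚ n = ℕtoℚ-mono-≤ {0} {n} z≤n

∣ℕtoℚ∣ : ∀ n → ∣ ℕtoℚ n ∣ ≡ ℕtoℚ n
∣ℕtoℚ∣ n = ℚ.0≤p⇒∣p∣≡p (0≤ℕtoℚ n)

ℕtoℚ-∸ : ∀ {a b} → b ℕ.≤ a → ℕtoℚ a - ℕtoℚ b ≡ ℕtoℚ (a ℕ.∸ b)
ℕtoℚ-∸ {a} {b} b≤a = begin
  ℕtoℚ a - ℕtoℚ b                     ≡⟨ cong (λ c → ℕtoℚ c - ℕtoℚ b) (ℕ.m+[n∸m]≡n b≤a) ⟨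
  ℕtoℚ (b ℕ.+ (a ℕ.∸ b)) - ℕtoℚ b     ≡⟨ cong (_- ℕtoℚ b) (ℕtoℚ-homo-+ b (a ℕ.∸ b)) ⟩
  ℕtoℚ b + ℕtoℚ (a ℕ.∸ b) - ℕtoℚ b    ≡⟨ solve 2 (λ u v → u :+ v :- u := v) refl (ℕtoℚ b) (ℕtoℚ (a ℕ.∸ b)) ⟩
  ℕtoℚ (a ℕ.∸ b)                      ∎
  where open ≡-Reasoning

∣ℕtoℚ-ℕtoℚ∣ : ∀ a b → ∣ ℕtoℚ a - ℕtoℚ b ∣ ≡ ℕtoℚ ℕ.∣ a - b ∣
∣ℕtoℚ-ℕtoℚ∣ a b with ℕ.≤-total b a
... | inj₁ b≤a = begin
  ∣ ℕtoℚ a - ℕtoℚ b ∣       ≡⟨ cong ∣_∣ (ℕtoℚ-∸ b≤a) ⟩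
  ∣ ℕtoℚ (a ℕ.∸ b) ∣        ≡⟨ ∣ℕtoℚ∣ (a ℕ.∸ b) ⟩
  ℕtoℚ (a ℕ.∸ b)            ≡⟨ cong ℕtoℚ (ℕ.m≤n⇒∣n-m∣≡n∸m b≤a) ⟨
  ℕtoℚ ℕ.∣ a - b ∣          ∎
  where open ≡-Reasoning
... | inj₂ a≤b = begin
  ∣ ℕtoℚ a - ℕtoℚ b ∣       ≡⟨ cong ∣_∣ (solve 2 (λ u v → u :- v := :- (v :- u)) refl (ℕtoℚ a) (ℕtoℚ b)) ⟩
  ∣ - (ℕtoℚ b - ℕtoℚ a) ∣   ≡⟨ ℚ.∣-p∣≡∣p∣ (ℕtoℚ b - ℕtoℚ a) ⟩
  ∣ ℕtoℚ b - ℕtoℚ a ∣       ≡⟨ cong ∣_∣ (ℕtoℚ-∸ a≤b) ⟩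
  ∣ ℕtoℚ (b ℕ.∸ a) ∣        ≡⟨ ∣ℕtoℚ∣ (b ℕ.∸ a) ⟩
  ℕtoℚ (b ℕ.∸ a)            ≡⟨ cong ℕtoℚ (ℕ.m≤n⇒∣m-n∣≡n∸m a≤b) ⟨
  ℕtoℚ ℕ.∣ a - b ∣          ∎
  where open ≡-Reasoning

Σℚ-single : ∀ {k} (i : Fin k) (f : Fin k → ℚ) → (∀ a → a ≢ i → f a ≡ 0ℚ) → Σℚ f ≡ f i
Σℚ-single {suc k} i f f≡0 = begin
  Σℚ f                                  ≡⟨ sum-remove {i = i} f ⟩
  f i + Σℚ (λ a → f (punchIn i a))      ≡⟨ cong (f i +_) (sum-cong-≗ (λ a → f≡0 _ (punchInᵢ≢i i a))) ⟩
  f i + Σℚ {k} (λ _ → 0ℚ)               ≡⟨ cong (f i +_) (sum-replicate-zero k) ⟩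
  f i + 0ℚ                              ≡⟨ ℚ.+-identityʳ (f i) ⟩
  f i                                   ∎
  where open ≡-Reasoning

identity-≡ : ∀ {k} (i j : Fin k) → toℕ i ≡ toℕ j → identity i j ≡ 1ℚ
identity-≡ i j i≡j with toℕ i ℕ.≟ toℕ j
... | yes _   = refl
... | no  i≢j = ⊥-elim (i≢j i≡j)

identity-≢ : ∀ {k} (i j : Fin k) → toℕ i ≢ toℕ j → identity i j ≡ 0ℚ
identity-≢ i j i≢j with toℕ i ℕ.≟ toℕ j
... | yes i≡j = ⊥-elim (i≢j i≡j)
... | no  _   = refl

Σℚ-identityˡ : ∀ {k} (i : Fin k) (f : Fin k → ℚ) → Σℚ (λ a → identity i a * f a) ≡ f i
Σℚ-identityˡ i f = begin
  Σℚ (λ a → identity i a * f a)   ≡⟨ Σℚ-single i _ (λ a a≢i → off-diagonal (a≢i ∘ toℕ-injective ∘ sym)) ⟩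
  identity i i * f i              ≡⟨ cong (_* f i) (identity-≡ i i refl) ⟩
  1ℚ * f i                        ≡⟨ ℚ.*-identityˡ (f i) ⟩
  f i                             ∎
  where
  open ≡-Reasoning
  off-diagonal : ∀ {a} → toℕ i ≢ toℕ a → identity i a * f a ≡ 0ℚ
  off-diagonal {a} i≢a = trans (cong (_* f a) (identity-≢ i a i≢a)) (ℚ.*-zeroˡ (f a))

Σℚ-identityʳ : ∀ {k} (j : Fin k) (f : Fin k → ℚ) → Σℚ (λ a → f a * identity a j) ≡ f j
Σℚ-identityʳ j f = begin
  Σℚ (λ a → f a * identity a j)   ≡⟨ Σℚ-single j _ (λ a a≢j → off-diagonal (a≢j ∘ toℕ-injective)) ⟩
  f j * identity j j              ≡⟨ cong (f j *_) (identity-≡ j j refl) ⟩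
  f j * 1ℚ                        ≡⟨ ℚ.*-identityʳ (f j) ⟩
  f j                             ∎
  where
  open ≡-Reasoning
  off-diagonal : ∀ {a} → toℕ a ≢ toℕ j → f a * identity a j ≡ 0ℚ
  off-diagonal {a} a≢j = trans (cong (f a *_) (identity-≢ a j a≢j)) (ℚ.*-zeroʳ (f a))

Poly : Set
Poly = ℕ → ℚ

one : Poly
one zero    = 1ℚ
one (suc _) = 0ℚ

[x-_]*_ : ℚ → Poly → Poly
([x- a ]* p) zero    = - (a * p 0)
([x- a ]* p) (suc m) = p m - a * p (suc m)

DegreeBelow : Poly → ℕ → Set
DegreeBelow p n = ∀ m → n ℕ.≤ m → p m ≡ 0ℚ

eval : ℕ → Poly → ℚ → ℚ
eval zero    p x = 0ℚ
eval (suc n) p x = p 0 + x * eval n (p ∘ suc) x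

eval-cong : ∀ n {p q} x → (∀ m → m ℕ.< n → p m ≡ q m) → eval n p x ≡ eval n q x
eval-cong zero    x p≡q = refl
eval-cong (suc n) x p≡q =
  cong₂ (λ u v → u + x * v) (p≡q 0 (s≤s z≤n)) (eval-cong n x (λ m m<n → p≡q (suc m) (s≤s m<n)))

eval-linear : ∀ n p q c x → eval n (λ m → p m + c * q m) x ≡ eval n p x + c * eval n q x
eval-linear zero    p q c x = solve 1 (λ c → con 0ℚ := con 0ℚ :+ c :* con 0ℚ) refl c
eval-linear (suc n) p q c x = begin
  p 0 + c * q 0 + x * eval n (λ m → p (suc m) + c * q (suc m)) x
    ≡⟨ cong (λ v → p 0 + c * q 0 + x * v) (eval-linear n (p ∘ suc) (q ∘ suc) c x) ⟩
  p 0 + c * q 0 + x * (eval n (p ∘ suc) x + c * eval n (q ∘ suc) x)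
    ≡⟨ solve 6 (λ p₀ q₀ c x e f → p₀ :+ c :* q₀ :+ x :* (e :+ c :* f) := p₀ :+ x :* e :+ c :* (q₀ :+ x :* f))
               refl (p 0) (q 0) c x (eval n (p ∘ suc) x) (eval n (q ∘ suc) x) ⟩
  p 0 + x * eval n (p ∘ suc) x + c * (q 0 + x * eval n (q ∘ suc) x) ∎
  where open ≡-Reasoning

eval-0 : ∀ n x → eval n (λ _ → 0ℚ) x ≡ 0ℚ
eval-0 zero    x = refl
eval-0 (suc n) x rewrite eval-0 n x = solve 1 (λ x → con 0ℚ :+ x :* con 0ℚ := con 0ℚ) refl x

eval-one : ∀ n x → eval (suc n) one x ≡ 1ℚ
eval-one n x rewrite eval-0 n x = solve 1 (λ x → con 1ℚ :+ x :* con 0ℚ := con 1ℚ) refl x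

eval-suc : ∀ n p x → DegreeBelow p n → eval (suc n) p x ≡ eval n p x
eval-suc zero    p x p<0 rewrite p<0 0 z≤n = solve 1 (λ x → con 0ℚ :+ x :* con 0ℚ := con 0ℚ) refl x
eval-suc (suc n) p x p<n = cong (λ v → p 0 + x * v) (eval-suc n (p ∘ suc) x (λ m n≤m → p<n (suc m) (s≤s n≤m)))

[x-]*-degree : ∀ a p n → DegreeBelow p n → DegreeBelow ([x- a ]* p) (suc n)
[x-]*-degree a p n p<n (suc m) (s≤s n≤m) rewrite p<n m n≤m | p<n (suc m) (ℕ.m≤n⇒m≤1+n n≤m) =
  solve 1 (λ a → con 0ℚ :- a :* con 0ℚ := con 0ℚ) refl a

eval-[x-]* : ∀ n a p x → DegreeBelow p n → eval (suc n) ([x- a ]* p) x ≡ (x - a) * eval n p x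
eval-[x-]* zero a p x p<0 rewrite p<0 0 z≤n =
  solve 2 (λ a x → :- (a :* con 0ℚ) :+ x :* con 0ℚ := (x :- a) :* con 0ℚ) refl a x
eval-[x-]* (suc n) a p x p<n = begin
  - (a * p 0) + x * eval (suc n) (λ m → p m - a * p (suc m)) x
    ≡⟨ cong (λ v → - (a * p 0) + x * v) (trans (eval-cong (suc n) x (λ m _ → sub-as-add (p m) (p (suc m))))
                                                (eval-linear (suc n) p (p ∘ suc) (- a) x)) ⟩
  - (a * p 0) + x * (p 0 + x * e + - a * eval (suc n) (p ∘ suc) x)
    ≡⟨ cong (λ v → - (a * p 0) + x * (p 0 + x * e + - a * v))
            (eval-suc n (p ∘ suc) x (λ m n≤m → p<n (suc m) (s≤s n≤m))) ⟩
  - (a * p 0) + x * (p 0 + x * e + - a * e)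
    ≡⟨ solve 4 (λ a p₀ x e → :- (a :* p₀) :+ x :* (p₀ :+ x :* e :+ :- a :* e) := (x :- a) :* (p₀ :+ x :* e))
               refl a (p 0) x e ⟩
  (x - a) * (p 0 + x * e) ∎
  where
  open ≡-Reasoning
  e = eval n (p ∘ suc) x
  sub-as-add : ∀ u v → u - a * v ≡ u + - a * v
  sub-as-add u v = solve 3 (λ a u v → u :- a :* v := u :+ :- a :* v) refl a u v

-- The coefficients of (p(x) - p(a)) / (x - a), for p of degree at most n.
quotient : ℕ → Poly → ℚ → Poly
quotient zero    p a m       = 0ℚ
quotient (suc n) p a zero    = eval (suc n) (p ∘ suc) a
quotient (suc n) p a (suc m) = quotient n (p ∘ suc) a m

quotient-degree : ∀ n p a → DegreeBelow (quotient n p a) n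
quotient-degree zero    p a m       _         = refl
quotient-degree (suc n) p a (suc m) (s≤s n≤m) = quotient-degree n (p ∘ suc) a m n≤m

division-coefficient : ∀ n p a m → m ℕ.≤ n →
                       p m ≡ ([x- a ]* quotient n p a) m + eval (suc n) p a * one m
division-coefficient zero p a zero _ =
  solve 2 (λ p₀ a → p₀ := :- (a :* con 0ℚ) :+ (p₀ :+ a :* con 0ℚ) :* con 1ℚ) refl (p 0) a
division-coefficient (suc n) p a zero _ =
  solve 3 (λ p₀ a r → p₀ := :- (a :* r) :+ (p₀ :+ a :* r) :* con 1ℚ) refl (p 0) a (eval (suc n) (p ∘ suc) a)
division-coefficient (suc n) p a (suc zero) _ =
  trans (division-coefficient n (p ∘ suc) a zero z≤n)
        (solve 4 (λ a q₀ r′ r → :- (a :* q₀) :+ r′ :* con 1ℚ := r′ :- a :* q₀ :+ r :* con 0ℚ) refl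
               a (quotient n (p ∘ suc) a 0) (eval (suc n) (p ∘ suc) a) (eval (suc (suc n)) p a))
division-coefficient (suc n) p a (suc (suc m)) (s≤s m≤n) =
  trans (division-coefficient n (p ∘ suc) a (suc m) m≤n)
        (cong (([x- a ]* quotient n (p ∘ suc) a) (suc m) +_)
              (trans (ℚ.*-zeroʳ (eval (suc n) (p ∘ suc) a)) (sym (ℚ.*-zeroʳ (eval (suc (suc n)) p a)))))

eval-division : ∀ n p a x → eval (suc n) p x ≡ (x - a) * eval n (quotient n p a) x + eval (suc n) p a
eval-division n p a x = begin
  eval (suc n) p x
    ≡⟨ eval-cong (suc n) x (λ m m<1+n → division-coefficient n p a m (ℕ.≤-pred m<1+n)) ⟩
  eval (suc n) (λ m → ([x- a ]* q) m + r * one m) x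
    ≡⟨ eval-linear (suc n) ([x- a ]* q) one r x ⟩
  eval (suc n) ([x- a ]* q) x + r * eval (suc n) one x
    ≡⟨ cong₂ (λ u v → u + r * v) (eval-[x-]* n a q x (quotient-degree n p a)) (eval-one n x) ⟩
  (x - a) * eval n q x + r * 1ℚ
    ≡⟨ cong ((x - a) * eval n q x +_) (ℚ.*-identityʳ r) ⟩
  (x - a) * eval n q x + r ∎
  where
  open ≡-Reasoning
  q = quotient n p a
  r = eval (suc n) p a

[x-]*-zero : ∀ a q → (∀ m → q m ≡ 0ℚ) → ∀ m → ([x- a ]* q) m ≡ 0ℚ
[x-]*-zero a q q≡0 zero rewrite q≡0 0 = solve 1 (λ a → :- (a :* con 0ℚ) := con 0ℚ) refl a
[x-]*-zero a q q≡0 (suc m) rewrite q≡0 m | q≡0 (suc m) = solve 1 (λ a → con 0ℚ :- a :* con 0ℚ := con 0ℚ) refl a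

*-cancelˡ-≡0 : ∀ p q → p ≢ 0ℚ → p * q ≡ 0ℚ → q ≡ 0ℚ
*-cancelˡ-≡0 p q p≢0 pq≡0 = begin
  q                ≡⟨ ℚ.*-identityˡ q ⟨
  1ℚ * q           ≡⟨ cong (_* q) (ℚ.*-inverseˡ p) ⟨
  1/ p * p * q     ≡⟨ ℚ.*-assoc (1/ p) p q ⟩
  1/ p * (p * q)   ≡⟨ cong (1/ p *_) pq≡0 ⟩
  1/ p * 0ℚ        ≡⟨ ℚ.*-zeroʳ (1/ p) ⟩
  0ℚ               ∎
  where
  open ≡-Reasoning
  instance _ = ℚ.≢-nonZero p≢0

module _ (x : ℕ → ℚ) (x-injective : ∀ {i r} → x i ≡ x r → i ≡ r) where

  vanishing-on-nodes⇒zero : ∀ n p → (∀ i → i ℕ.< n → eval n p (x i) ≡ 0ℚ) → ∀ m → m ℕ.< n → p m ≡ 0ℚ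
  vanishing-on-nodes⇒zero (suc n) p p[x]≡0 m (s≤s m≤n) = begin
    p m                                  ≡⟨ division-coefficient n p (x n) m m≤n ⟩
    ([x- x n ]* q) m + r * one m         ≡⟨ cong₂ _+_ ([x-]*-zero (x n) q q≡0 m) (cong (_* one m) r≡0) ⟩
    0ℚ + 0ℚ * one m                      ≡⟨ solve 1 (λ c → con 0ℚ :+ con 0ℚ :* c := con 0ℚ) refl (one m) ⟩
    0ℚ                                   ∎
    where
    open ≡-Reasoning
    q = quotient n p (x n)
    r = eval (suc n) p (x n)
    r≡0 : r ≡ 0ℚ
    r≡0 = p[x]≡0 n ℕ.≤-refl
    q[x]≡0 : ∀ i → i ℕ.< n → eval n q (x i) ≡ 0ℚ
    q[x]≡0 i i<n = *-cancelˡ-≡0 (x i - x n) (eval n q (x i))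
      (λ xᵢ-xₙ≡0 → ℕ.<⇒≢ i<n (x-injective (p-q≡0⇒p≡q (x i) (x n) xᵢ-xₙ≡0)))
      (begin
        (x i - x n) * eval n q (x i)          ≡⟨ ℚ.+-identityʳ _ ⟨
        (x i - x n) * eval n q (x i) + 0ℚ     ≡⟨ cong ((x i - x n) * eval n q (x i) +_) r≡0 ⟨
        (x i - x n) * eval n q (x i) + r      ≡⟨ eval-division n p (x n) (x i) ⟨
        eval (suc n) p (x i)                  ≡⟨ p[x]≡0 i (ℕ.m≤n⇒m≤1+n i<n) ⟩
        0ℚ                                    ∎)
    q≡0 : ∀ m → q m ≡ 0ℚ
    q≡0 m with m ℕ.<? n
    ... | yes m<n = vanishing-on-nodes⇒zero n q q[x]≡0 m m<n
    ... | no  m≮n = quotient-degree n p (x n) m (ℕ.≮⇒≥ m≮n)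

  agreement-on-nodes⇒equal : ∀ n p q → (∀ i → i ℕ.< n → eval n p (x i) ≡ eval n q (x i)) →
                              ∀ m → m ℕ.< n → p m ≡ q m
  agreement-on-nodes⇒equal n p q p[x]≡q[x] m m<n =
    p-q≡0⇒p≡q (p m) (q m) (trans (minus-as-linear (p m) (q m))
      (vanishing-on-nodes⇒zero n (λ m → p m + - 1ℚ * q m) difference-vanishes m m<n))
    where
    minus-as-linear : ∀ u v → u - v ≡ u + - 1ℚ * v
    minus-as-linear u v = solve 2 (λ u v → u :- v := u :+ con (- 1ℚ) :* v) refl u v
    difference-vanishes : ∀ i → i ℕ.< n → eval n (λ m → p m + - 1ℚ * q m) (x i) ≡ 0ℚ
    difference-vanishes i i<n = begin
      eval n (λ m → p m + - 1ℚ * q m) (x i)       ≡⟨ eval-linear n p q (- 1ℚ) (x i) ⟩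
      eval n p (x i) + - 1ℚ * eval n q (x i)      ≡⟨ cong (λ v → v + - 1ℚ * eval n q (x i)) (p[x]≡q[x] i i<n) ⟩
      eval n q (x i) + - 1ℚ * eval n q (x i)      ≡⟨ solve 1 (λ v → v :+ con (- 1ℚ) :* v := con 0ℚ) refl (eval n q (x i)) ⟩
      0ℚ                                        ∎
      where open ≡-Reasoning

node : ℕ → ℚ
node r = ℕtoℚ (2 ^ r)

node-injective : ∀ {i r} → node i ≡ node r → i ≡ r
node-injective = 2^-injective ∘ ℕtoℚ-injective

lagrangeNumerator : ℕ → ℕ → Poly
lagrangeNumerator k j = foldExcept (λ r → [x- node r ]*_) one k j

numeratorValue : ℕ → ℕ → ℚ → ℚ
numeratorValue k j x = foldExcept (λ r → (x - node r) *_) 1ℚ k j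

DegreeBelow-mono : ∀ {p m n} → m ℕ.≤ n → DegreeBelow p m → DegreeBelow p n
DegreeBelow-mono m≤n p<m o n≤o = p<m o (ℕ.≤-trans m≤n n≤o)

lagrangeNumerator-degree : ∀ k j → DegreeBelow (lagrangeNumerator k j) (suc k)
lagrangeNumerator-degree zero    j (suc m) _ = refl
lagrangeNumerator-degree (suc k) j with k ℕ.≟ j
... | yes _ = DegreeBelow-mono (ℕ.n≤1+n (suc k)) (lagrangeNumerator-degree k j)
... | no  _ = [x-]*-degree (node k) (lagrangeNumerator k j) (suc k) (lagrangeNumerator-degree k j)

lagrangeNumerator-degree-< : ∀ {k j} → j ℕ.< k → DegreeBelow (lagrangeNumerator k j) k
lagrangeNumerator-degree-< {suc k} {j} (s≤s j≤k) with k ℕ.≟ j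
... | yes _   = lagrangeNumerator-degree k j
... | no  k≢j = [x-]*-degree (node k) (lagrangeNumerator k j) k
                  (lagrangeNumerator-degree-< (ℕ.≤∧≢⇒< j≤k (≢-sym k≢j)))

eval-lagrangeNumerator : ∀ k j x → eval (suc k) (lagrangeNumerator k j) x ≡ numeratorValue k j x
eval-lagrangeNumerator zero    j x = solve 1 (λ x → con 1ℚ :+ x :* con 0ℚ := con 1ℚ) refl x
eval-lagrangeNumerator (suc k) j x with k ℕ.≟ j
... | yes _ = trans (eval-suc (suc k) (lagrangeNumerator k j) x (lagrangeNumerator-degree k j))
                    (eval-lagrangeNumerator k j x)
... | no  _ = trans (eval-[x-]* (suc k) (node k) (lagrangeNumerator k j) x (lagrangeNumerator-degree k j))
                    (cong ((x - node k) *_) (eval-lagrangeNumerator k j x))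

eval-lagrangeNumerator-< : ∀ {k j} x → j ℕ.< k → eval k (lagrangeNumerator k j) x ≡ numeratorValue k j x
eval-lagrangeNumerator-< {k} {j} x j<k =
  trans (sym (eval-suc k (lagrangeNumerator k j) x (lagrangeNumerator-degree-< j<k)))
        (eval-lagrangeNumerator k j x)

numeratorValue-other-node : ∀ {k j i} → i ℕ.< k → i ≢ j → numeratorValue k j (node i) ≡ 0ℚ
numeratorValue-other-node {suc k} {j} {i} (s≤s i≤k) i≢j with k ℕ.≟ j
... | yes refl = numeratorValue-other-node (ℕ.≤∧≢⇒< i≤k i≢j) i≢j
... | no  _ with i ℕ.≟ k
...   | yes refl = trans (cong (_* numeratorValue k j (node i)) (ℚ.+-inverseʳ (node i)))
                         (ℚ.*-zeroˡ (numeratorValue k j (node i)))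
...   | no  i≢k  = trans (cong ((node i - node k) *_) (numeratorValue-other-node (ℕ.≤∧≢⇒< i≤k i≢k) i≢j))
                         (ℚ.*-zeroʳ (node i - node k))

∣numeratorValue-own-node∣ : ∀ k j → ∣ numeratorValue k j (node j) ∣ ≡ ℕtoℚ (gapProduct k j)
∣numeratorValue-own-node∣ zero    j = refl
∣numeratorValue-own-node∣ (suc k) j with k ℕ.≟ j
... | yes _ = ∣numeratorValue-own-node∣ k j
... | no  _ = begin
  ∣ (node j - node k) * numeratorValue k j (node j) ∣
    ≡⟨ ℚ.∣p*q∣≡∣p∣*∣q∣ (node j - node k) _ ⟩
  ∣ node j - node k ∣ * ∣ numeratorValue k j (node j) ∣
    ≡⟨ cong₂ _*_ (∣ℕtoℚ-ℕtoℚ∣ (2 ^ j) (2 ^ k)) (∣numeratorValue-own-node∣ k j) ⟩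
  ℕtoℚ ℕ.∣ 2 ^ j - 2 ^ k ∣ * ℕtoℚ (gapProduct k j)
    ≡⟨ ℕtoℚ-homo-* ℕ.∣ 2 ^ j - 2 ^ k ∣ (gapProduct k j) ⟨
  ℕtoℚ (ℕ.∣ 2 ^ j - 2 ^ k ∣ ℕ.* gapProduct k j) ∎
  where open ≡-Reasoning

[x-]*-bound : ∀ a b p → 0ℚ ≤ a → (∀ m → ∣ p m ∣ ≤ b) → ∀ m → ∣ ([x- a ]* p) m ∣ ≤ (1ℚ + a) * b
[x-]*-bound a b p 0≤a ∣p∣≤b m =
  ℚ.≤-trans (bound m) (ℚ.≤-reflexive (solve 2 (λ a b → b :+ a :* b := (con 1ℚ :+ a) :* b) refl a b))
  where
  instance _ = ℚ.nonNegative 0≤a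
  open ℚ.≤-Reasoning
  0≤b : 0ℚ ≤ b
  0≤b = ℚ.≤-trans (ℚ.0≤∣p∣ (p 0)) (∣p∣≤b 0)
  ∣a*p∣≤a*b : ∀ m → ∣ a * p m ∣ ≤ a * b
  ∣a*p∣≤a*b m = begin
    ∣ a * p m ∣       ≡⟨ ℚ.∣p*q∣≡∣p∣*∣q∣ a (p m) ⟩
    ∣ a ∣ * ∣ p m ∣   ≡⟨ cong (_* ∣ p m ∣) (ℚ.0≤p⇒∣p∣≡p 0≤a) ⟩
    a * ∣ p m ∣       ≤⟨ ℚ.*-monoˡ-≤-nonNeg a (∣p∣≤b m) ⟩
    a * b             ∎
  bound : ∀ m → ∣ ([x- a ]* p) m ∣ ≤ b + a * b
  bound zero = begin
    ∣ - (a * p 0) ∣   ≡⟨ ℚ.∣-p∣≡∣p∣ (a * p 0) ⟩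
    ∣ a * p 0 ∣       ≤⟨ ∣a*p∣≤a*b 0 ⟩
    a * b             ≡⟨ ℚ.+-identityˡ (a * b) ⟨
    0ℚ + a * b        ≤⟨ ℚ.+-monoˡ-≤ (a * b) 0≤b ⟩
    b + a * b         ∎
  bound (suc m) = begin
    ∣ p m - a * p (suc m) ∣           ≤⟨ ℚ.∣p-q∣≤∣p∣+∣q∣ (p m) (a * p (suc m)) ⟩
    ∣ p m ∣ + ∣ a * p (suc m) ∣       ≤⟨ ℚ.+-mono-≤ (∣p∣≤b m) (∣a*p∣≤a*b (suc m)) ⟩
    b + a * b                         ∎

∣lagrangeNumerator∣≤coeffBound : ∀ k j m → ∣ lagrangeNumerator k j m ∣ ≤ ℕtoℚ (coeffBound k j)
∣lagrangeNumerator∣≤coeffBound zero    j zero    = ℚ.≤-refl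
∣lagrangeNumerator∣≤coeffBound zero    j (suc m) = 0≤ℕtoℚ 1
∣lagrangeNumerator∣≤coeffBound (suc k) j m with k ℕ.≟ j
... | yes _ = ∣lagrangeNumerator∣≤coeffBound k j m
... | no  _ = begin
  ∣ ([x- node k ]* lagrangeNumerator k j) m ∣
    ≤⟨ [x-]*-bound (node k) _ (lagrangeNumerator k j) (0≤ℕtoℚ (2 ^ k)) (∣lagrangeNumerator∣≤coeffBound k j) m ⟩
  (1ℚ + node k) * ℕtoℚ (coeffBound k j)        ≡⟨ cong (_* ℕtoℚ (coeffBound k j)) (ℕtoℚ-homo-+ 1 (2 ^ k)) ⟨
  ℕtoℚ (1 ℕ.+ 2 ^ k) * ℕtoℚ (coeffBound k j)  ≡⟨ ℕtoℚ-homo-* (1 ℕ.+ 2 ^ k) (coeffBound k j) ⟨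
  ℕtoℚ ((1 ℕ.+ 2 ^ k) ℕ.* coeffBound k j)     ∎
  where open ℚ.≤-Reasoning

·-assoc : ∀ {k} (A B C : Matrix k) i j → ((A · B) · C) i j ≡ (A · (B · C)) i j
·-assoc A B C i j = begin
  Σℚ (λ b → Σℚ (λ m → A i m * B m b) * C b j)
    ≡⟨ sum-cong-≗ (λ b → *-distribʳ-sum (C b j) (λ m → A i m * B m b)) ⟩
  Σℚ (λ b → Σℚ (λ m → A i m * B m b * C b j))
    ≡⟨ ∑-comm (λ b m → A i m * B m b * C b j) ⟩
  Σℚ (λ m → Σℚ (λ b → A i m * B m b * C b j))
    ≡⟨ sum-cong-≗ (λ m → sum-cong-≗ (λ b → ℚ.*-assoc (A i m) (B m b) (C b j))) ⟩
  Σℚ (λ m → Σℚ (λ b → A i m * (B m b * C b j)))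
    ≡⟨ sum-cong-≗ (λ m → *-distribˡ-sum (A i m) (λ b → B m b * C b j)) ⟨
  Σℚ (λ m → A i m * Σℚ (λ b → B m b * C b j)) ∎
  where open ≡-Reasoning

·-identityˡ : ∀ {k} (A : Matrix k) i j → (identity · A) i j ≡ A i j
·-identityˡ A i j = Σℚ-identityˡ i (λ b → A b j)

·-identityʳ : ∀ {k} (A : Matrix k) i j → (A · identity) i j ≡ A i j
·-identityʳ A i j = Σℚ-identityʳ j (A i)

extend : ∀ {n} → (Fin n → ℚ) → Poly
extend {zero}  f m       = 0ℚ
extend {suc n} f zero    = f fzero
extend {suc n} f (suc m) = extend (f ∘ fsuc) m

extend-toℕ : ∀ {n} (f : Fin n → ℚ) i → extend f (toℕ i) ≡ f i
extend-toℕ f fzero    = refl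
extend-toℕ f (fsuc i) = extend-toℕ (f ∘ fsuc) i

Σ-powers≡eval : ∀ n b p → Σℚ {n} (λ m → ℕtoℚ (b ^ toℕ m) * p (toℕ m)) ≡ eval n p (ℕtoℚ b)
Σ-powers≡eval zero    b p = refl
Σ-powers≡eval (suc n) b p = cong₂ _+_ (ℚ.*-identityˡ (p 0)) (begin
  Σℚ {n} (λ m → ℕtoℚ (b ℕ.* b ^ toℕ m) * p (suc (toℕ m)))
    ≡⟨ sum-cong-≗ {n} (λ m → trans (cong (_* p (suc (toℕ m))) (ℕtoℚ-homo-* b (b ^ toℕ m)))
                                (ℚ.*-assoc (ℕtoℚ b) (ℕtoℚ (b ^ toℕ m)) (p (suc (toℕ m))))) ⟩
  Σℚ {n} (λ m → ℕtoℚ b * (ℕtoℚ (b ^ toℕ m) * p (suc (toℕ m))))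
    ≡⟨ *-distribˡ-sum {n} (ℕtoℚ b) (λ m → ℕtoℚ (b ^ toℕ m) * p (suc (toℕ m))) ⟨
  ℕtoℚ b * Σℚ {n} (λ m → ℕtoℚ (b ^ toℕ m) * p (suc (toℕ m)))
    ≡⟨ cong (ℕtoℚ b *_) (Σ-powers≡eval n b (p ∘ suc)) ⟩
  ℕtoℚ b * eval n (p ∘ suc) (ℕtoℚ b) ∎)
  where open ≡-Reasoning

M-row≡eval : ∀ k i p → Σℚ (λ m → M k i m * p (toℕ m)) ≡ eval k p (node (toℕ i))
M-row≡eval k i p = begin
  Σℚ {k} (λ m → ℕtoℚ (2 ^ (toℕ i ℕ.* toℕ m)) * p (toℕ m))
    ≡⟨ sum-cong-≗ {k} (λ m → cong (λ e → ℕtoℚ e * p (toℕ m)) (ℕ.^-*-assoc 2 (toℕ i) (toℕ m))) ⟨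
  Σℚ {k} (λ m → ℕtoℚ ((2 ^ toℕ i) ^ toℕ m) * p (toℕ m))
    ≡⟨ Σ-powers≡eval k (2 ^ toℕ i) p ⟩
  eval k p (node (toℕ i)) ∎
  where open ≡-Reasoning

M·column≡eval : ∀ k (A : Matrix k) i l → (M k · A) i l ≡ eval k (extend (λ m → A m l)) (node (toℕ i))
M·column≡eval k A i l =
  trans (sum-cong-≗ (λ m → cong (M k i m *_) (sym (extend-toℕ (λ m → A m l) m))))
        (M-row≡eval k i (extend (λ m → A m l)))

lagrangeDenominator : ℕ → ℕ → ℚ
lagrangeDenominator k j = numeratorValue k j (node j)

lagrangeDenominator≢0 : ∀ k j → lagrangeDenominator k j ≢ 0ℚ
lagrangeDenominator≢0 k j d≡0 = ℚ.<-irrefl (sym (begin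
  ℕtoℚ (gapProduct k j)            ≡⟨ ∣numeratorValue-own-node∣ k j ⟨
  ∣ lagrangeDenominator k j ∣      ≡⟨ cong ∣_∣ d≡0 ⟩
  0ℚ                               ∎)) (ℕtoℚ-mono-< (gapProduct>0 k j))
  where open ≡-Reasoning

lagrangeDenominator⁻¹ : ℕ → ℕ → ℚ
lagrangeDenominator⁻¹ k j = (1/ lagrangeDenominator k j) {{ℚ.≢-nonZero (lagrangeDenominator≢0 k j)}}

lagrangeDenominator-inverse : ∀ k j → lagrangeDenominator k j * lagrangeDenominator⁻¹ k j ≡ 1ℚ
lagrangeDenominator-inverse k j =
  ℚ.*-inverseʳ (lagrangeDenominator k j) {{ℚ.≢-nonZero (lagrangeDenominator≢0 k j)}}

lagrangeInverse : (k : ℕ) → Matrix k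
lagrangeInverse k m j = lagrangeNumerator k (toℕ j) (toℕ m) * lagrangeDenominator⁻¹ k (toℕ j)

M·lagrangeInverse : ∀ k i j → (M k · lagrangeInverse k) i j ≡ identity i j
M·lagrangeInverse k i j = begin
  Σℚ {k} (λ m → M k i m * (P (toℕ m) * d⁻¹))
    ≡⟨ sum-cong-≗ {k} (λ m → ℚ.*-assoc (M k i m) (P (toℕ m)) d⁻¹) ⟨
  Σℚ (λ m → M k i m * P (toℕ m) * d⁻¹)
    ≡⟨ *-distribʳ-sum d⁻¹ (λ m → M k i m * P (toℕ m)) ⟨
  Σℚ (λ m → M k i m * P (toℕ m)) * d⁻¹
    ≡⟨ cong (_* d⁻¹) (M-row≡eval k i P) ⟩
  eval k P (node (toℕ i)) * d⁻¹
    ≡⟨ cong (_* d⁻¹) (eval-lagrangeNumerator-< (node (toℕ i)) (toℕ<n j)) ⟩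
  numeratorValue k (toℕ j) (node (toℕ i)) * d⁻¹
    ≡⟨ at-node (toℕ i ℕ.≟ toℕ j) ⟩
  identity i j ∎
  where
  open ≡-Reasoning
  P = lagrangeNumerator k (toℕ j)
  d⁻¹ = lagrangeDenominator⁻¹ k (toℕ j)
  at-node : Dec (toℕ i ≡ toℕ j) → numeratorValue k (toℕ j) (node (toℕ i)) * d⁻¹ ≡ identity i j
  at-node (yes i≡j) = begin
    numeratorValue k (toℕ j) (node (toℕ i)) * d⁻¹   ≡⟨ cong (λ r → numeratorValue k (toℕ j) (node r) * d⁻¹) i≡j ⟩
    lagrangeDenominator k (toℕ j) * d⁻¹             ≡⟨ lagrangeDenominator-inverse k (toℕ j) ⟩
    1ℚ                                              ≡⟨ identity-≡ i j i≡j ⟨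
    identity i j                                    ∎
  at-node (no i≢j) = begin
    numeratorValue k (toℕ j) (node (toℕ i)) * d⁻¹   ≡⟨ cong (_* d⁻¹) (numeratorValue-other-node (toℕ<n i) i≢j) ⟩
    0ℚ * d⁻¹                                        ≡⟨ ℚ.*-zeroˡ d⁻¹ ⟩
    0ℚ                                              ≡⟨ identity-≢ i j i≢j ⟨
    identity i j                                    ∎

lagrangeInverse·M : ∀ k j l → (lagrangeInverse k · M k) j l ≡ identity j l
lagrangeInverse·M k j l = begin
  (N · M k) j l                  ≡⟨ extend-toℕ (λ m → (N · M k) m l) j ⟨
  extend (λ m → (N · M k) m l) (toℕ j)
    ≡⟨ agreement-on-nodes⇒equal node node-injective k _ _ same-values (toℕ j) (toℕ<n j) ⟩
  extend (λ m → identity m l) (toℕ j) ≡⟨ extend-toℕ (λ m → identity m l) j ⟩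
  identity j l                   ∎
  where
  open ≡-Reasoning
  N = lagrangeInverse k
  same-values : ∀ i → i ℕ.< k →
    eval k (extend (λ m → (N · M k) m l)) (node i) ≡ eval k (extend (λ m → identity m l)) (node i)
  same-values i i<k = begin
    eval k (extend (λ m → (N · M k) m l)) (node i)        ≡⟨ cong (λ r → eval k _ (node r)) (toℕ-fromℕ< i<k) ⟨
    eval k (extend (λ m → (N · M k) m l)) (node (toℕ iₖ))  ≡⟨ M·column≡eval k (N · M k) iₖ l ⟨
    (M k · (N · M k)) iₖ l                                ≡⟨ ·-assoc (M k) N (M k) iₖ l ⟨
    ((M k · N) · M k) iₖ l                                ≡⟨ sum-cong-≗ (λ b → cong (_* M k b l) (M·lagrangeInverse k iₖ b)) ⟩
    (identity · M k) iₖ l                                 ≡⟨ ·-identityˡ (M k) iₖ l ⟩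
    M k iₖ l                                              ≡⟨ ·-identityʳ (M k) iₖ l ⟨
    (M k · identity) iₖ l                                 ≡⟨ M·column≡eval k identity iₖ l ⟩
    eval k (extend (λ m → identity m l)) (node (toℕ iₖ))  ≡⟨ cong (λ r → eval k _ (node r)) (toℕ-fromℕ< i<k) ⟩
    eval k (extend (λ m → identity m l)) (node i)         ∎
    where iₖ = fromℕ< i<k

∣lagrangeInverse∣<34 : ∀ k m j → ∣ lagrangeInverse k m j ∣ < ℕtoℚ 34
∣lagrangeInverse∣<34 k m j = ℚ.*-cancelʳ-<-nonNeg ∣ d ∣ {{ℚ.∣-∣-nonNeg d}} (begin-strict
  ∣ lagrangeInverse k m j ∣ * ∣ d ∣   ≡⟨ ℚ.∣p*q∣≡∣p∣*∣q∣ (lagrangeInverse k m j) d ⟨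
  ∣ lagrangeInverse k m j * d ∣       ≡⟨ cong ∣_∣ numerator-recovered ⟩
  ∣ c ∣                               ≤⟨ ∣lagrangeNumerator∣≤coeffBound k j′ (toℕ m) ⟩
  ℕtoℚ (coeffBound k j′)              ≤⟨ ℕtoℚ-mono-≤ (coeffBound≤20*gapProduct (toℕ<n j)) ⟩
  ℕtoℚ (20 ℕ.* gapProduct k j′)       <⟨ ℕtoℚ-mono-< 20w<34w ⟩
  ℕtoℚ (34 ℕ.* gapProduct k j′)       ≡⟨ ℕtoℚ-homo-* 34 (gapProduct k j′) ⟩
  ℕtoℚ 34 * ℕtoℚ (gapProduct k j′)    ≡⟨ cong (ℕtoℚ 34 *_) (∣numeratorValue-own-node∣ k j′) ⟨
  ℕtoℚ 34 * ∣ d ∣                     ∎)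
  where
  open ℚ.≤-Reasoning
  j′ = toℕ j
  d = lagrangeDenominator k j′
  c = lagrangeNumerator k j′ (toℕ m)
  20w<34w : 20 ℕ.* gapProduct k j′ ℕ.< 34 ℕ.* gapProduct k j′
  20w<34w = ℕ.*-monoˡ-< (gapProduct k j′) {{ℕ.>-nonZero (gapProduct>0 k j′)}} (ℕ.m<m+n 20 {14} (s≤s z≤n))
  numerator-recovered : c * lagrangeDenominator⁻¹ k j′ * d ≡ c
  numerator-recovered = begin-equality
    c * lagrangeDenominator⁻¹ k j′ * d     ≡⟨ ℚ.*-assoc c _ d ⟩
    c * (lagrangeDenominator⁻¹ k j′ * d)   ≡⟨ cong (c *_) (trans (ℚ.*-comm _ d) (lagrangeDenominator-inverse k j′)) ⟩
    c * 1ℚ                                ≡⟨ ℚ.*-identityʳ c ⟩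
    c                                     ∎

proposition10 : (k : ℕ) → 1 ℕ.≤ k →
    Σ (Matrix k) (λ N → IsInverse (M k) N × (∀ i j → ∣ N i j ∣ < ℕtoℚ 34))
proposition10 k _ = lagrangeInverse k , (M·lagrangeInverse k , lagrangeInverse·M k) , ∣lagrangeInverse∣<34 k
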